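{- Let $(G,k)$ be a reduced instance of diamond-free editing. (i) Any two big maximal cliques of $G$ share at most one vertex. (ii) If $(G,k)$ is a yes-instance, then for every solution $E_\pm$ of $(G,k)$, every big maximal clique of $G$ is a maximal clique of $G\triangle E_\pm$.
   Context: Graphs are finite, simple, undirected; $N(v)$ is the neighborhood of $v$. A diamond is $K_4$ minus one edge; diamond-free means no induced diamond. For a set $E_+$ of non-edges and a set $E_-$ of edges of $G$, $E_\pm=E_+\cup E_-$ and $G\triangle E_\pm$ is the graph on $V(G)$ with edge set $(E(G)\cup E_+)\setminus E_-$. A solution of instance $(G,k)$ is such a pair with $G\triangle E_\pm$ diamond-free and $|E_\pm|\le k$; yes-instance means a solution exists. $(G,k)$ is reduced if (1) there is no non-edge $uv$ with $2k+2$ distinct vertices $x_1,y_1,\dots,x_{k+1},y_{k+1}\in N(u)\cap N(v)$ such that $x_iy_i\in E(G)$ for all $i$, and (2) there is no edge $uv$ with $2k+2$ distinct vertices $x_1,y_1,\dots,x_{k+1},y_{k+1}\in N(u)\cap N(v)$ such that $x_iy_i\notin E(G)$ for all $i$. A maximal clique of $G$ is big if it has at least $3k+2$ vertices. -}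

module Defs where

open import Data.Nat using (ℕ; suc; _+_; _*_; _≤_)
open import Data.Fin using (Fin; _<?_)
open import Data.Fin.Subset using (Subset; _∈_; _∉_; ∣_∣; _∩_)
open import Data.Bool using (Bool; true; false; if_then_else_; _∧_; _xor_)
open import Data.List using (List; map; allFin)
open import Data.Nat.ListAction using (sum)
open import Data.Sum using (_⊎_; [_,_])
open import Data.Product using (Σ; ∃; _×_; _,_)
open import Data.Empty using (⊥)
open import Function.Definitions using (Injective)
open import Relation.Nullary using (¬_; ⌊_⌋)
open import Relation.Binary.PropositionalEquality using (_≡_; _≢_)

record Graph (n : ℕ) : Set where
  field
    adj    : Fin n → Fin n → Bool
    sym    : ∀ u v → adj u v ≡ adj v u
    irrefl : ∀ v → adj v v ≡ false
open Graph public

Edge : ∀ {n} → Graph n → Fin n → Fin n → Set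
Edge G u v = adj G u v ≡ true

NonEdge : ∀ {n} → Graph n → Fin n → Fin n → Set
NonEdge G u v = (u ≢ v) × (adj G u v ≡ false)

InducedDiamond : ∀ {n} → Graph n → Fin n → Fin n → Fin n → Fin n → Set
InducedDiamond G a b c d =
  (a ≢ b) × (a ≢ c) × (a ≢ d) × (b ≢ c) × (b ≢ d) × (c ≢ d) ×
  Edge G a b × Edge G a c × Edge G a d × Edge G b c × Edge G b d ×
  adj G c d ≡ false

DiamondFree : ∀ {n} → Graph n → Set
DiamondFree G = ∀ a b c d → ¬ InducedDiamond G a b c d

-- An edit set E± = E₊ ∪ E₋, represented as the set of unordered vertex
-- pairs it contains (a symmetric irreflexive Boolean function).
-- E₊ = pairs in it that are non-edges of G, E₋ = pairs that are edges of G.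
record EditSet (n : ℕ) : Set where
  field
    mem    : Fin n → Fin n → Bool
    msym   : ∀ u v → mem u v ≡ mem v u
    mirrefl : ∀ v → mem v v ≡ false
open EditSet public

size : ∀ {n} → EditSet n → ℕ
size {n} F = sum (map (λ i → sum (map (λ j →
  if ⌊ i <? j ⌋ ∧ mem F i j then 1 else 0) (allFin n))) (allFin n))

-- G △ E± : edge set (E(G) ∪ E₊) ∖ E₋, i.e. adjacency xor membership in E±.
_△_ : ∀ {n} → Graph n → EditSet n → Graph n
adj    (G △ F) u v = adj G u v xor mem F u v
sym    (G △ F) u v rewrite Graph.sym G u v | msym F u v = _≡_.refl
irrefl (G △ F) v rewrite Graph.irrefl G v | mirrefl F v = _≡_.refl

Solution : ∀ {n} → Graph n → ℕ → EditSet n → Set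
Solution G k F = DiamondFree (G △ F) × size F ≤ k

YesInstance : ∀ {n} → Graph n → ℕ → Set
YesInstance G k = ∃ λ F → Solution G k F

InCommonNbhd : ∀ {n} → Graph n → Fin n → Fin n → Fin n → Set
InCommonNbhd G u v x = Edge G u x × Edge G v x

Witnesses : ∀ {n} → Graph n → ℕ → Bool → Fin n → Fin n → Set
Witnesses {n} G k b u v =
  Σ (Fin (suc k) → Fin n) λ x → Σ (Fin (suc k) → Fin n) λ y →
    Injective _≡_ _≡_ [ x , y ] ×
    (∀ i → InCommonNbhd G u v (x i) × InCommonNbhd G u v (y i)
           × adj G (x i) (y i) ≡ b)

Reduced : ∀ {n} → Graph n → ℕ → Set
Reduced G k =
  (∀ u v → NonEdge G u v → ¬ Witnesses G k true u v) ×
  (∀ u v → Edge G u v → ¬ Witnesses G k false u v)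

IsClique : ∀ {n} → Graph n → Subset n → Set
IsClique G C = ∀ u v → u ∈ C → v ∈ C → u ≢ v → Edge G u v

IsMaximalClique : ∀ {n} → Graph n → Subset n → Set
IsMaximalClique G C =
  IsClique G C × (∀ w → w ∉ C → ¬ (∀ u → u ∈ C → Edge G u w))

IsBigMaximalClique : ∀ {n} → Graph n → ℕ → Subset n → Set
IsBigMaximalClique G k C = IsMaximalClique G C × 3 * k + 2 ≤ ∣ C ∣

module Submission where

-- The engine is one counting fact (many-non-neighbours): a vertex b that
-- misses a member a of a big clique C misses at least k+1 members of C.
-- Otherwise b has 2k+2 neighbours in C; cut into k+1 pairs they are
-- common neighbours of the non-edge ab, adjacent in pairs: rule (1).
--
-- (i)  If big maximal cliques C ≠ D share u ≠ v, pick a ∈ C ∖ D and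
--      b ∈ D not adjacent to a.  The ≥ k+1 non-neighbours of b in C lie
--      outside D and each has ≥ k+1 non-neighbours in D; a greedy matching
--      yields k+1 disjoint non-adjacent pairs in N(u) ∩ N(v): rule (2).
-- (ii) An edit uv inside a big clique C forces, for each of k disjoint
--      pairs {x,y} ⊆ C ∖ {u,v}, a further edit in the K₄ on {x,y,u,v}
--      (else it becomes a diamond); a vertex w ∉ C adjacent to all of C
--      after editing forces the k+1 non-neighbours of w in C to be edited.
--      Either way a solution would make more than k edits.

open import Defs hiding (sym)
open import Data.Nat using (ℕ; zero; suc; _+_; _*_; _≤_; _<_; _≤?_; s≤s; s≤s⁻¹)
open import Data.Nat.Properties
  using (≤-trans; n≤1+n; +-suc; +-monoˡ-≤; +-cancelˡ-≤; m≤m+n; <⇒≱; ≰⇒>; module ≤-Reasoning)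
open import Data.Nat.ListAction using (sum)
open import Data.Nat.ListAction.Properties using (sum-++)
open import Data.Nat.Tactic.RingSolver using (solve-∀)
open import Data.Fin using (Fin; zero; suc; _<?_; inject≤; _↑ˡ_; _↑ʳ_; join; splitAt)
  renaming (_<_ to _<ᶠ_)
open import Data.Fin.Properties
  using (suc-injective; inject≤-injective; injective⇒≤; any?; all?; ¬∀⟶∃¬; _≟_; <-cmp; splitAt-join)
open import Data.Fin.Subset using (Subset; inside; outside; _∈_; _∉_; _⊆_; ∣_∣; _∩_; _─_; _-_; ⁅_⁆)
open import Data.Fin.Subset.Properties
  using (∣p∩q∣≤∣q∣; ∣⁅x⁆∣≡1; p─q⊆p; x∉⁅y⁆⇒x≢y; x∈p∩q⁻; x∈p∧x∉q⇒x∈p─q; nonempty?; ⊆-antisym)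
  renaming (_∈?_ to _∈ₛ?_)
open import Data.Vec using ([]; _∷_; here; there; tabulate)
open import Data.Vec.Properties using (lookup∘tabulate; []=⇒lookup; lookup⇒[]=)
open import Data.Vec.Functional as Vector using ()
open import Data.Bool using (Bool; true; false; not; _∧_; _xor_; if_then_else_; T)
open import Data.List using (List; []; _∷_; map; _++_; length; lookup; filterᵇ; allFin; cartesianProduct)
open import Data.List.Properties using (map-++; map-∘)
open import Data.List.Membership.Propositional using () renaming (_∈_ to _∈ₗ_)
open import Data.List.Membership.Propositional.Properties using (∈-filter⁺; ∈-allFin; ∈-cartesianProduct⁺)
open import Data.List.Relation.Unary.Any using (index)
open import Data.List.Relation.Unary.Any.Properties using (lookup-index)
open import Data.Sum using (_⊎_; inj₁; inj₂; [_,_]; [_,_]′)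
open import Data.Sum.Properties using (inj₁-injective; inj₂-injective)
open import Data.Product using (∃-syntax; _×_; _,_; proj₁; proj₂; swap; uncurry)
open import Data.Empty using (⊥; ⊥-elim)
open import Function using (_∘_)
open import Function.Definitions using (Injective)
open import Relation.Nullary using (¬_; Dec; yes; no; ⌊_⌋; contradiction)
open import Relation.Nullary.Decidable using (T?; dec-true; isYes≗does)
open import Relation.Binary.Definitions using (tri<; tri≈; tri>)
open import Relation.Binary.PropositionalEquality
  using (_≡_; _≢_; refl; sym; trans; cong; cong₂; subst; module ≡-Reasoning)

private
  variable
    A B : Set
    m n k : ℕ

-- Counting members of subsets of Fin n

enumerate : (p : Subset n) → Fin ∣ p ∣ → Fin n
enumerate (inside  ∷ p) zero    = zero
enumerate (inside  ∷ p) (suc i) = suc (enumerate p i)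
enumerate (outside ∷ p) i       = suc (enumerate p i)

enumerate-∈ : (p : Subset n) (i : Fin ∣ p ∣) → enumerate p i ∈ p
enumerate-∈ (inside  ∷ p) zero    = here
enumerate-∈ (inside  ∷ p) (suc i) = there (enumerate-∈ p i)
enumerate-∈ (outside ∷ p) i       = there (enumerate-∈ p i)

enumerate-injective : (p : Subset n) → Injective _≡_ _≡_ (enumerate p)
enumerate-injective (inside  ∷ p) {zero}  {zero}  _  = refl
enumerate-injective (inside  ∷ p) {suc i} {suc j} eq = cong suc (enumerate-injective p (suc-injective eq))
enumerate-injective (outside ∷ p) eq = enumerate-injective p (suc-injective eq)

choose : (p : Subset n) → m ≤ ∣ p ∣ →
         ∃[ f ] Injective _≡_ _≡_ f × (∀ (i : Fin m) → f i ∈ p)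
choose p m≤∣p∣ =
  (λ i → enumerate p (inject≤ i m≤∣p∣)) ,
  (λ eq → inject≤-injective _ _ _ _ (enumerate-injective p eq)) ,
  (λ i → enumerate-∈ p (inject≤ i m≤∣p∣))

-- A subset with more than m members has a member outside the image of any
-- f : Fin m → Fin n; otherwise choosing preimages would inject p into Fin m.
fresh : (p : Subset n) (f : Fin m → Fin n) → m < ∣ p ∣ →
        ∃[ x ] x ∈ p × (∀ i → f i ≢ x)
fresh {m = m} p f m<∣p∣ with all? (λ j → any? (λ i → f i ≟ enumerate p j))
... | no some-missed =
  let j , missed = ¬∀⟶∃¬ _ _ (λ j → any? (λ i → f i ≟ enumerate p j)) some-missed
  in enumerate p j , enumerate-∈ p j , λ i fi≡ → missed (i , fi≡)
... | yes all-hit = contradiction (injective⇒≤ preimage-injective) (<⇒≱ m<∣p∣)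
  where
  preimage : Fin ∣ p ∣ → Fin m
  preimage j = proj₁ (all-hit j)
  preimage-injective : Injective _≡_ _≡_ preimage
  preimage-injective {j} {j′} eq = enumerate-injective p (begin
    enumerate p j   ≡⟨ sym (proj₂ (all-hit j)) ⟩
    f (preimage j)  ≡⟨ cong f eq ⟩
    f (preimage j′) ≡⟨ proj₂ (all-hit j′) ⟩
    enumerate p j′  ∎)
    where open ≡-Reasoning

∣p∣≡∣p∩q∣+∣p─q∣ : (p q : Subset n) → ∣ p ∣ ≡ ∣ p ∩ q ∣ + ∣ p ─ q ∣
∣p∣≡∣p∩q∣+∣p─q∣ []            []            = refl
∣p∣≡∣p∩q∣+∣p─q∣ (inside  ∷ p) (inside  ∷ q) = cong suc (∣p∣≡∣p∩q∣+∣p─q∣ p q)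
∣p∣≡∣p∩q∣+∣p─q∣ (inside  ∷ p) (outside ∷ q) = trans (cong suc (∣p∣≡∣p∩q∣+∣p─q∣ p q)) (sym (+-suc _ _))
∣p∣≡∣p∩q∣+∣p─q∣ (outside ∷ p) (inside  ∷ q) = ∣p∣≡∣p∩q∣+∣p─q∣ p q
∣p∣≡∣p∩q∣+∣p─q∣ (outside ∷ p) (outside ∷ q) = ∣p∣≡∣p∩q∣+∣p─q∣ p q

x∈p─q⁻ : {x : Fin n} (p q : Subset n) → x ∈ p ─ q → x ∈ p × x ∉ q
x∈p─q⁻ p q x∈p─q = p─q⊆p p q x∈p─q , x∉q p q x∈p─q
  where
  x∉q : ∀ {n} {x : Fin n} (p q : Subset n) → x ∈ p ─ q → x ∉ q
  x∉q (_ ∷ p) (outside ∷ q) (there x∈p─q) (there x∈q) = x∉q p q x∈p─q x∈q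
  x∉q (_ ∷ p) (inside  ∷ q) (there x∈p─q) (there x∈q) = x∉q p q x∈p─q x∈q

∣p∣≤1+∣p-x∣ : (p : Subset n) (x : Fin n) → ∣ p ∣ ≤ suc ∣ p - x ∣
∣p∣≤1+∣p-x∣ p x = begin
  ∣ p ∣                     ≡⟨ ∣p∣≡∣p∩q∣+∣p─q∣ p ⁅ x ⁆ ⟩
  ∣ p ∩ ⁅ x ⁆ ∣ + ∣ p - x ∣ ≤⟨ +-monoˡ-≤ _ (∣p∩q∣≤∣q∣ p ⁅ x ⁆) ⟩
  ∣ ⁅ x ⁆ ∣ + ∣ p - x ∣     ≡⟨ cong (_+ ∣ p - x ∣) (∣⁅x⁆∣≡1 x) ⟩
  suc ∣ p - x ∣             ∎
  where open ≤-Reasoning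

⊆-or-outside : (C D : Subset n) → C ⊆ D ⊎ ∃[ a ] a ∈ C × a ∉ D
⊆-or-outside C D with nonempty? (C ─ D)
... | yes (a , a∈C─D) = inj₂ (a , x∈p─q⁻ C D a∈C─D)
... | no  none        = inj₁ C⊆D
  where
  C⊆D : C ⊆ D
  C⊆D {x} x∈C with x ∈ₛ? D
  ... | yes x∈D = x∈D
  ... | no  x∉D = contradiction (x , x∈p∧x∉q⇒x∈p─q x∈C x∉D) none

-- Injections, pairings and matchings

∷-injective : {a : Fin n} {f : Fin m → Fin n} → Injective _≡_ _≡_ f →
              (∀ i → f i ≢ a) → Injective _≡_ _≡_ (a Vector.∷ f)
∷-injective f-inj a∉f {zero}  {zero}  _  = refl
∷-injective f-inj a∉f {zero}  {suc j} eq = contradiction (sym eq) (a∉f j)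
∷-injective f-inj a∉f {suc i} {zero}  eq = contradiction eq (a∉f i)
∷-injective f-inj a∉f {suc i} {suc j} eq = cong suc (f-inj eq)

[,]-injective : {f g : Fin m → A} → Injective _≡_ _≡_ f → Injective _≡_ _≡_ g →
                (∀ i j → f i ≢ g j) → Injective _≡_ _≡_ [ f , g ]
[,]-injective f-inj g-inj disjoint {inj₁ i} {inj₁ j} eq = cong inj₁ (f-inj eq)
[,]-injective f-inj g-inj disjoint {inj₁ i} {inj₂ j} eq = contradiction eq (disjoint i j)
[,]-injective f-inj g-inj disjoint {inj₂ i} {inj₁ j} eq = contradiction (sym eq) (disjoint j i)
[,]-injective f-inj g-inj disjoint {inj₂ i} {inj₂ j} eq = cong inj₂ (g-inj eq)

record Pairing (m : ℕ) (S : Subset n) : Set where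
  field
    fst snd   : Fin m → Fin n
    injective : Injective _≡_ _≡_ [ fst , snd ]
    entry∈    : ∀ s → [ fst , snd ] s ∈ S

  fst≢snd : ∀ i → fst i ≢ snd i
  fst≢snd i eq = contradiction (injective {inj₁ i} {inj₂ i} eq) λ ()

-- A set with 2m members contains m disjoint pairs: list 2m members
-- without repetition and cut the list into halves.
pairing : (S : Subset n) → m + m ≤ ∣ S ∣ → Pairing m S
pairing {m = m} S 2m≤∣S∣ with h , h-injective , h∈S ← choose S 2m≤∣S∣ = record
  { fst       = h ∘ (_↑ˡ m)
  ; snd       = h ∘ (m ↑ʳ_)
  ; injective = halves-injective
  ; entry∈    = λ { (inj₁ i) → h∈S (i ↑ˡ m) ; (inj₂ i) → h∈S (m ↑ʳ i) } }
  where
  via-join : ∀ s → [ h ∘ (_↑ˡ m) , h ∘ (m ↑ʳ_) ] s ≡ h (join m m s)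
  via-join (inj₁ _) = refl
  via-join (inj₂ _) = refl
  halves-injective : Injective _≡_ _≡_ [ h ∘ (_↑ˡ m) , h ∘ (m ↑ʳ_) ]
  halves-injective {s} {t} eq = begin
    s                      ≡⟨ sym (splitAt-join m m s) ⟩
    splitAt m (join m m s) ≡⟨ cong (splitAt m) joins-equal ⟩
    splitAt m (join m m t) ≡⟨ splitAt-join m m t ⟩
    t                      ∎
    where
    open ≡-Reasoning
    joins-equal : join m m s ≡ join m m t
    joins-equal = h-injective (trans (sym (via-join s)) (trans eq (via-join t)))

record Matching (m : ℕ) (A : Subset n) (B : Fin n → Subset n) : Set where
  field
    left right      : Fin m → Fin n
    left-injective  : Injective _≡_ _≡_ left
    right-injective : Injective _≡_ _≡_ right
    left∈           : ∀ i → left i ∈ A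
    right∈          : ∀ i → right i ∈ B (left i)

-- Greedy matching: if A and every B x (x ∈ A) have at least m members, a
-- matching of size m exists, since before each of the m steps fewer than
-- m ends have been used on either side.
greedyMatching : ∀ m (A : Subset n) (B : Fin n → Subset n) → m ≤ ∣ A ∣ →
                 (∀ x → x ∈ A → m ≤ ∣ B x ∣) → Matching m A B
greedyMatching zero A B _ _ = record
  { left  = λ () ; right = λ () ; left-injective = λ { {()} } ; right-injective = λ { {()} }
  ; left∈ = λ () ; right∈ = λ () }
greedyMatching (suc m) A B m<∣A∣ m<∣B∣
  with smaller ← greedyMatching m A B (≤-trans (n≤1+n m) m<∣A∣)
                                      (λ x x∈A → ≤-trans (n≤1+n m) (m<∣B∣ x x∈A))
  with x , x∈A , x-new ← fresh A (Matching.left smaller) m<∣A∣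
  with y , y∈B , y-new ← fresh (B x) (Matching.right smaller) (m<∣B∣ x x∈A) = record
  { left            = x Vector.∷ left
  ; right           = y Vector.∷ right
  ; left-injective  = ∷-injective left-injective x-new
  ; right-injective = ∷-injective right-injective y-new
  ; left∈           = λ { zero → x∈A ; (suc i) → left∈ i }
  ; right∈          = λ { zero → y∈B ; (suc i) → right∈ i } }
  where open Matching smaller

-- Counting edits

indicator : Bool → ℕ
indicator b = if b then 1 else 0

-- An injection from Fin m into the entries of a list forces length ≥ m:
-- the positions in the list separate the images.
injection≤length : (xs : List A) (f : Fin m → A) → Injective _≡_ _≡_ f →
                   (∀ i → f i ∈ₗ xs) → m ≤ length xs
injection≤length xs f f-injective f∈xs = injective⇒≤ position-injective
  where
  position-injective : Injective _≡_ _≡_ (λ i → index (f∈xs i))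
  position-injective {i} {j} eq = f-injective (begin
    f i                        ≡⟨ lookup-index (f∈xs i) ⟩
    lookup xs (index (f∈xs i)) ≡⟨ cong (lookup xs) eq ⟩
    lookup xs (index (f∈xs j)) ≡⟨ sym (lookup-index (f∈xs j)) ⟩
    f j                        ∎)
    where open ≡-Reasoning

count≡length-filter : (P : A → Bool) (xs : List A) →
                      sum (map (indicator ∘ P) xs) ≡ length (filterᵇ P xs)
count≡length-filter P []       = refl
count≡length-filter P (x ∷ xs) with P x
... | true  = cong suc (count≡length-filter P xs)
... | false = count≡length-filter P xs

injection≤count : (P : A → Bool) (xs : List A) (f : Fin m → A) → Injective _≡_ _≡_ f →
                  (∀ i → f i ∈ₗ xs) → (∀ i → P (f i) ≡ true) →
                  m ≤ sum (map (indicator ∘ P) xs)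
injection≤count P xs f f-injective f∈xs Pf =
  subst (_ ≤_) (sym (count≡length-filter P xs))
    (injection≤length (filterᵇ P xs) f f-injective
      (λ i → ∈-filter⁺ (T? ∘ P) (f∈xs i) (subst T (sym (Pf i)) _)))

sum-nested : (g : A → B → ℕ) (xs : List A) (ys : List B) →
             sum (map (λ a → sum (map (g a) ys)) xs) ≡ sum (map (uncurry g) (cartesianProduct xs ys))
sum-nested g []       ys = refl
sum-nested g (x ∷ xs) ys = begin
  sum (map (g x) ys) + sum (map (λ a → sum (map (g a) ys)) xs)
    ≡⟨ cong₂ _+_ (cong sum (map-∘ ys)) (sum-nested g xs ys) ⟩
  sum (map (uncurry g) (map (x ,_) ys)) + sum (map (uncurry g) (cartesianProduct xs ys))
    ≡⟨ sym (sum-++ (map (uncurry g) (map (x ,_) ys)) _) ⟩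
  sum (map (uncurry g) (map (x ,_) ys) ++ map (uncurry g) (cartesianProduct xs ys))
    ≡⟨ cong sum (sym (map-++ (uncurry g) (map (x ,_) ys) _)) ⟩
  sum (map (uncurry g) (map (x ,_) ys ++ cartesianProduct xs ys)) ∎
  where open ≡-Reasoning

SamePair : (p q : Fin n × Fin n) → Set
SamePair p q = p ≡ q ⊎ p ≡ swap q

-- The representative (i , j) with i ≤ j of an unordered pair; `size`
-- counts edits in this form.
orient : Fin n × Fin n → Fin n × Fin n
orient (a , b) with <-cmp a b
... | tri< _ _ _ = a , b
... | tri≈ _ _ _ = a , b
... | tri> _ _ _ = b , a

orient-samePair : (p : Fin n × Fin n) → SamePair (orient p) p
orient-samePair (a , b) with <-cmp a b
... | tri< _ _ _ = inj₁ refl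
... | tri≈ _ _ _ = inj₁ refl
... | tri> _ _ _ = inj₂ refl

orient-injective : (p q : Fin n × Fin n) → orient p ≡ orient q → SamePair p q
orient-injective p q eq with orient-samePair p | orient-samePair q
... | inj₁ p′≡p | inj₁ q′≡q = inj₁ (trans (sym p′≡p) (trans eq q′≡q))
... | inj₁ p′≡p | inj₂ q′≡q = inj₂ (trans (sym p′≡p) (trans eq q′≡q))
... | inj₂ p′≡p | inj₁ q′≡q = inj₂ (cong swap (trans (sym p′≡p) (trans eq q′≡q)))
... | inj₂ p′≡p | inj₂ q′≡q = inj₁ (cong swap (trans (sym p′≡p) (trans eq q′≡q)))

orient-sorted : (a b : Fin n) → a ≢ b →
                (a <ᶠ b × orient (a , b) ≡ (a , b)) ⊎ (b <ᶠ a × orient (a , b) ≡ (b , a))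
orient-sorted a b a≢b with <-cmp a b
... | tri< a<b _ _ = inj₁ (a<b , refl)
... | tri≈ _ a≡b _ = contradiction a≡b a≢b
... | tri> _ _ b<a = inj₂ (b<a , refl)

counted : EditSet n → Fin n × Fin n → Bool
counted F (i , j) = ⌊ i <? j ⌋ ∧ mem F i j

⌊⌋-true : {P : Set} (d : Dec P) → P → ⌊ d ⌋ ≡ true
⌊⌋-true d p = trans (isYes≗does d) (dec-true d p)

edit-ends-differ : (F : EditSet n) {a b : Fin n} → mem F a b ≡ true → a ≢ b
edit-ends-differ F {a} ab∈F refl = contradiction (trans (sym ab∈F) (mirrefl F a)) λ ()

orient-counted : (F : EditSet n) (a b : Fin n) → mem F a b ≡ true →
                 counted F (orient (a , b)) ≡ true
orient-counted F a b ab∈F with orient-sorted a b (edit-ends-differ F ab∈F)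
... | inj₁ (a<b , eq) = subst (λ o → counted F o ≡ true) (sym eq)
                          (cong₂ _∧_ (⌊⌋-true (a <? b) a<b) ab∈F)
... | inj₂ (b<a , eq) = subst (λ o → counted F o ≡ true) (sym eq)
                          (cong₂ _∧_ (⌊⌋-true (b <? a) b<a) (trans (msym F b a) ab∈F))

edits≤size : (F : EditSet n) (e : Fin m → Fin n × Fin n) →
             (∀ {i j} → SamePair (e i) (e j) → i ≡ j) →
             (∀ i → uncurry (mem F) (e i) ≡ true) → m ≤ size F
edits≤size {n} F e e-distinct e∈F =
  subst (_ ≤_) (sym (sum-nested (λ i j → indicator (counted F (i , j))) (allFin n) (allFin n)))
    (injection≤count (counted F) (cartesianProduct (allFin n) (allFin n)) (orient ∘ e)
      (λ eq → e-distinct (orient-injective _ _ eq))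
      (λ i → ∈-cartesianProduct⁺ (∈-allFin _) (∈-allFin _))
      (λ i → orient-counted F _ _ (e∈F i)))

-- Arithmetic of the bound 3k + 2

3k+2-split : ∀ k → k + suc k + suc k ≡ 3 * k + 2
3k+2-split = solve-∀

3k+2-unfold : ∀ k → 3 * k + 2 ≡ suc (suc (k + k + k))
3k+2-unfold = solve-∀

big-split : ∀ k s t → 3 * k + 2 ≤ s + t → s ≤ k + suc k → suc k ≤ t
big-split k s t big s≤2k+1 = +-cancelˡ-≤ (k + suc k) (suc k) t (begin
  k + suc k + suc k ≡⟨ 3k+2-split k ⟩
  3 * k + 2         ≤⟨ big ⟩
  s + t             ≤⟨ +-monoˡ-≤ t s≤2k+1 ⟩
  k + suc k + t     ∎)
  where open ≤-Reasoning

big-minus-two : (C : Subset n) (u v : Fin n) → 3 * k + 2 ≤ ∣ C ∣ → k + k ≤ ∣ C - u - v ∣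
big-minus-two {k = k} C u v big = ≤-trans (m≤m+n (k + k) k) (s≤s⁻¹ (s≤s⁻¹ (begin
  suc (suc (k + k + k))   ≡⟨ sym (3k+2-unfold k) ⟩
  3 * k + 2               ≤⟨ big ⟩
  ∣ C ∣                   ≤⟨ ∣p∣≤1+∣p-x∣ C u ⟩
  suc ∣ C - u ∣           ≤⟨ s≤s (∣p∣≤1+∣p-x∣ (C - u) v) ⟩
  suc (suc ∣ C - u - v ∣) ∎)))
  where open ≤-Reasoning

∈-minus-two : {C : Subset n} {u v z : Fin n} → z ∈ C - u - v → z ∈ C × z ≢ u × z ≢ v
∈-minus-two {C = C} {u} {v} z∈C-u-v =
  let z∈C-u , z∉⁅v⁆ = x∈p─q⁻ (C - u) _ z∈C-u-v
      z∈C   , z∉⁅u⁆ = x∈p─q⁻ C _ z∈C-u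
  in z∈C , x∉⁅y⁆⇒x≢y z∉⁅u⁆ , x∉⁅y⁆⇒x≢y z∉⁅v⁆

-- Graphs, cliques and edits

nbhd : Graph n → Fin n → Subset n
nbhd G v = tabulate (adj G v)

nbhd⁻ : (G : Graph n) {v x : Fin n} → x ∈ nbhd G v → Edge G v x
nbhd⁻ G {v} {x} x∈N = trans (sym (lookup∘tabulate (adj G v) x)) ([]=⇒lookup x∈N)

nbhd⁺ : (G : Graph n) {v x : Fin n} → Edge G v x → x ∈ nbhd G v
nbhd⁺ G {v} {x} vx = lookup⇒[]= x _ (trans (lookup∘tabulate (adj G v) x) vx)

∉nbhd : (G : Graph n) {v x : Fin n} → x ∉ nbhd G v → adj G v x ≡ false
∉nbhd G {v} {x} x∉N with adj G v x in vx
... | true  = contradiction (nbhd⁺ G vx) x∉N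
... | false = refl

adj-separates : (G : Graph n) {b x y : Fin n} → Edge G b x → adj G b y ≡ false → x ≢ y
adj-separates G bx b≁y refl = contradiction (trans (sym bx) b≁y) λ ()

-- In a reduced instance a vertex b missing a member
-- a of a big clique C misses at least k+1 members of C: with 2k+2
-- neighbours of b in C, cut into k+1 pairs, reduction rule (1) would
-- apply to the non-edge ab.
many-non-neighbours : (G : Graph n) → Reduced G k → {C : Subset n} → IsClique G C →
                      3 * k + 2 ≤ ∣ C ∣ → {a b : Fin n} → a ∈ C → NonEdge G a b →
                      suc k ≤ ∣ C ─ nbhd G b ∣
many-non-neighbours {k = k} G reduced {C} clique big {a} {b} a∈C (a≢b , a≁b)
  with suc k + suc k ≤? ∣ C ∩ nbhd G b ∣
... | no few = big-split k _ _ (subst (3 * k + 2 ≤_) (∣p∣≡∣p∩q∣+∣p─q∣ C (nbhd G b)) big)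
                 (s≤s⁻¹ (≰⇒> few))
... | yes many = contradiction witnesses (proj₁ reduced a b (a≢b , a≁b))
  where
  open Pairing (pairing {m = suc k} (C ∩ nbhd G b) many)
  in-C : ∀ s → [ fst , snd ] s ∈ C
  in-C s = proj₁ (x∈p∩q⁻ C (nbhd G b) (entry∈ s))
  common : ∀ s → InCommonNbhd G a b ([ fst , snd ] s)
  common s = clique a _ a∈C (in-C s) (λ a≡z → adj-separates G b∼z b≁a (sym a≡z)) , b∼z
    where
    b∼z = nbhd⁻ G (proj₂ (x∈p∩q⁻ C (nbhd G b) (entry∈ s)))
    b≁a = trans (Graph.sym G b a) a≁b
  witnesses : Witnesses G k true a b
  witnesses = fst , snd , injective , λ i →
    common (inj₁ i) , common (inj₂ i) , clique _ _ (in-C (inj₁ i)) (in-C (inj₂ i)) (fst≢snd i)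

misses-member : (G : Graph n) {C : Subset n} → IsMaximalClique G C → {w : Fin n} → w ∉ C →
                ∃[ a ] a ∈ C × NonEdge G a w
misses-member G {C} (_ , maximal) {w} w∉C with nonempty? (C ─ nbhd G w)
... | yes (a , a∈C─N) =
  let a∈C , a∉N = x∈p─q⁻ C (nbhd G w) a∈C─N
  in a , a∈C , (λ { refl → w∉C a∈C }) , trans (Graph.sym G a w) (∉nbhd G a∉N)
... | no none = contradiction all-adjacent (maximal w w∉C)
  where
  all-adjacent : ∀ u → u ∈ C → Edge G u w
  all-adjacent u u∈C with u ∈ₛ? nbhd G w
  ... | yes u∈N = trans (Graph.sym G u w) (nbhd⁻ G u∈N)
  ... | no  u∉N = contradiction (u , x∈p∧x∉q⇒x∈p─q u∈C u∉N) none

maximal-⊆ : (G : Graph n) {C D : Subset n} → IsMaximalClique G C → IsClique G D → C ⊆ D → C ≡ D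
maximal-⊆ G {C} {D} (_ , maximal) clique-D C⊆D = ⊆-antisym C⊆D D⊆C
  where
  D⊆C : D ⊆ C
  D⊆C {w} w∈D with w ∈ₛ? C
  ... | yes w∈C = w∈C
  ... | no  w∉C = contradiction
        (λ u u∈C → clique-D u w (C⊆D u∈C) w∈D λ { refl → w∉C u∈C }) (maximal w w∉C)

record Gap (H : Graph n) (x y u v : Fin n) : Set where
  constructor mkGap
  field
    p q  : Fin n
    p-on : p ≡ x ⊎ p ≡ y
    q-on : (q ≡ x ⊎ q ≡ y) ⊎ (q ≡ u ⊎ q ≡ v)
    p≢q  : p ≢ q
    p≁q  : adj H p q ≡ false

diamond-gap : (H : Graph n) → DiamondFree H → {x y u v : Fin n} →
              x ≢ y → x ≢ u → x ≢ v → y ≢ u → y ≢ v → u ≢ v → adj H u v ≡ false →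
              Gap H x y u v
diamond-gap H diamond-free {x} {y} {u} {v} x≢y x≢u x≢v y≢u y≢v u≢v u≁v
  with adj H x y in xy | adj H x u in xu | adj H x v in xv | adj H y u in yu | adj H y v in yv
... | false | _     | _     | _     | _     = mkGap _ _ (inj₁ refl) (inj₁ (inj₂ refl)) x≢y xy
... | true  | false | _     | _     | _     = mkGap _ _ (inj₁ refl) (inj₂ (inj₁ refl)) x≢u xu
... | true  | true  | false | _     | _     = mkGap _ _ (inj₁ refl) (inj₂ (inj₂ refl)) x≢v xv
... | true  | true  | true  | false | _     = mkGap _ _ (inj₂ refl) (inj₂ (inj₁ refl)) y≢u yu
... | true  | true  | true  | true  | false = mkGap _ _ (inj₂ refl) (inj₂ (inj₂ refl)) y≢v yv
... | true  | true  | true  | true  | true  = contradiction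
      (x≢y , x≢u , x≢v , y≢u , y≢v , u≢v , xy , xu , xv , yu , yv , u≁v) (diamond-free x y u v)

edited : (G : Graph n) (F : EditSet n) (a b : Fin n) {s : Bool} →
         adj G a b ≡ s → adj (G △ F) a b ≡ not s → mem F a b ≡ true
edited G F a b g h = toggled (adj G a b) (mem F a b) (trans h (cong not (sym g)))
  where
  toggled : ∀ g e → g xor e ≡ not g → e ≡ true
  toggled g     true  _  = refl
  toggled true  false ()
  toggled false false ()

within-budget : (G : Graph n) (F : EditSet n) → Solution G k F → ¬ (suc k ≤ size F)
within-budget G F (_ , size≤k) k<size = <⇒≱ k<size size≤k

-- Part (i): big maximal cliques share at most one vertex

-- Pick a ∈ C ∖ D
-- (C ⊆ D would force C = D) and b ∈ D not adjacent to a.  A greedy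
-- matching between the non-neighbours of b in C (all outside D) and their
-- non-neighbours in D gives k+1 disjoint non-adjacent pairs, all in
-- N(u) ∩ N(v), against reduction rule (2) for the edge uv.
no-two-shared : (G : Graph n) → Reduced G k → {C D : Subset n} →
                IsBigMaximalClique G k C → IsBigMaximalClique G k D → C ≢ D →
                {u v : Fin n} → u ∈ C → u ∈ D → v ∈ C → v ∈ D → u ≢ v → ⊥
no-two-shared {k = k} G reduced {C} {D} (maxC , bigC) (maxD , bigD) C≢D {u} {v} u∈C u∈D v∈C v∈D u≢v
  with ⊆-or-outside C D
... | inj₁ C⊆D = C≢D (maximal-⊆ G maxC (proj₁ maxD) C⊆D)
... | inj₂ (a , a∈C , a∉D) with b , b∈D , b≢a , b≁a ← misses-member G maxD a∉D =
  contradiction witnesses (proj₂ reduced u v (cliqueC u v u∈C v∈C u≢v))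
  where
  cliqueC = proj₁ maxC
  cliqueD = proj₁ maxD
  b∉C : b ∉ C
  b∉C b∈C = contradiction (trans (sym (cliqueC b a b∈C a∈C b≢a)) b≁a) λ ()
  outside-D : ∀ {x} → x ∈ C ─ nbhd G b → x ∉ D
  outside-D {x} x∈ x∈D =
    let x∈C , x∉N = x∈p─q⁻ C (nbhd G b) x∈
    in contradiction (trans (sym (cliqueD b x b∈D x∈D λ { refl → b∉C x∈C })) (∉nbhd G x∉N)) λ ()
  many-left : suc k ≤ ∣ C ─ nbhd G b ∣
  many-left = many-non-neighbours G reduced cliqueC bigC a∈C
                ((λ a≡b → b≢a (sym a≡b)) , trans (Graph.sym G a b) b≁a)
  many-right : ∀ x → x ∈ C ─ nbhd G b → suc k ≤ ∣ D ─ nbhd G x ∣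
  many-right x x∈ = let d , d∈D , d≁x = misses-member G maxD (outside-D x∈)
                    in many-non-neighbours G reduced cliqueD bigD d∈D d≁x
  open Matching (greedyMatching (suc k) (C ─ nbhd G b) (λ x → D ─ nbhd G x) many-left many-right)
  left∈C : ∀ i → left i ∈ C
  left∈C i = proj₁ (x∈p─q⁻ C (nbhd G b) (left∈ i))
  right∈D : ∀ i → right i ∈ D
  right∈D i = proj₁ (x∈p─q⁻ D (nbhd G (left i)) (right∈ i))
  left≁right : ∀ i → adj G (left i) (right i) ≡ false
  left≁right i = ∉nbhd G (proj₂ (x∈p─q⁻ D (nbhd G (left i)) (right∈ i)))
  shared∼left : ∀ {w} → w ∈ C → w ∈ D → ∀ i → Edge G w (left i)
  shared∼left w∈C w∈D i = cliqueC _ _ w∈C (left∈C i) λ { refl → outside-D (left∈ i) w∈D }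
  shared∼right : ∀ {w} → w ∈ C → w ∈ D → ∀ i → Edge G w (right i)
  shared∼right {w} w∈C w∈D i = cliqueD _ _ w∈D (right∈D i)
    (adj-separates G (trans (Graph.sym G (left i) w) (shared∼left w∈C w∈D i)) (left≁right i))
  witnesses : Witnesses G k false u v
  witnesses = left , right ,
    [,]-injective left-injective right-injective
      (λ i j eq → outside-D (left∈ i) (subst (_∈ D) (sym eq) (right∈D j))) ,
    λ i → (shared∼left u∈C u∈D i , shared∼left v∈C v∈D i) ,
          (shared∼right u∈C u∈D i , shared∼right v∈C v∈D i) , left≁right i

share-at-most-one : (G : Graph n) → Reduced G k → ∀ C D →
                    IsBigMaximalClique G k C → IsBigMaximalClique G k D → C ≢ D → ∣ C ∩ D ∣ ≤ 1
share-at-most-one G reduced C D bigC bigD C≢D with 2 ≤? ∣ C ∩ D ∣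
... | no  fewer = s≤s⁻¹ (≰⇒> fewer)
... | yes two with f , f-injective , f∈C∩D ← choose (C ∩ D) two =
  ⊥-elim (no-two-shared G reduced bigC bigD C≢D (proj₁ (shared zero)) (proj₂ (shared zero))
            (proj₁ (shared (suc zero))) (proj₂ (shared (suc zero)))
            (λ eq → contradiction (f-injective eq) λ ()))
  where
  shared = λ i → x∈p∩q⁻ C D (f∈C∩D i)

-- Part (ii): big maximal cliques survive every solution

-- An edit uv inside a big clique C would force, for each of k disjoint
-- pairs {x , y} ⊆ C ∖ {u , v}, a further edit pq with p ∈ {x , y} inside
-- the K₄ on {x , y , u , v} (else that K₄ is a diamond of G △ F).  These
-- and uv are k+1 different edits.
no-edit-inside : (G : Graph n) (F : EditSet n) → Solution G k F →
                 {C : Subset n} → IsClique G C → 3 * k + 2 ≤ ∣ C ∣ →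
                 {u v : Fin n} → u ∈ C → v ∈ C → u ≢ v → mem F u v ≢ true
no-edit-inside {n = n} {k = k} G F solution {C} clique big {u} {v} u∈C v∈C u≢v uv∈F =
  within-budget G F solution (edits≤size F edit edit-distinct edit∈F)
  where
  open Pairing (pairing {m = k} (C - u - v) (big-minus-two {k = k} C u v big))
  OnPair : Fin k → Fin n → Set
  OnPair i z = z ≡ fst i ⊎ z ≡ snd i
  on-one-pair : ∀ {i j z} → OnPair i z → OnPair j z → i ≡ j
  on-one-pair {i} {j} (inj₁ refl) (inj₁ eq) = inj₁-injective (injective {inj₁ i} {inj₁ j} eq)
  on-one-pair {i} {j} (inj₁ refl) (inj₂ eq) = contradiction (injective {inj₁ i} {inj₂ j} eq) λ ()
  on-one-pair {i} {j} (inj₂ refl) (inj₁ eq) = contradiction (injective {inj₂ i} {inj₁ j} eq) λ ()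
  on-one-pair {i} {j} (inj₂ refl) (inj₂ eq) = inj₂-injective (injective {inj₂ i} {inj₂ j} eq)
  on-pair-∈ : ∀ {i z} → OnPair i z → z ∈ C × z ≢ u × z ≢ v
  on-pair-∈ {i} (inj₁ refl) = ∈-minus-two (entry∈ (inj₁ i))
  on-pair-∈ {i} (inj₂ refl) = ∈-minus-two (entry∈ (inj₂ i))
  uv-deleted : adj (G △ F) u v ≡ false
  uv-deleted = cong₂ _xor_ (clique u v u∈C v∈C u≢v) uv∈F
  gap : ∀ i → Gap (G △ F) (fst i) (snd i) u v
  gap i = diamond-gap (G △ F) (proj₁ solution) (fst≢snd i)
            (proj₁ (proj₂ x∈)) (proj₂ (proj₂ x∈)) (proj₁ (proj₂ y∈)) (proj₂ (proj₂ y∈)) u≢v uv-deleted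
    where
    x∈ = on-pair-∈ {i} (inj₁ refl)
    y∈ = on-pair-∈ {i} (inj₂ refl)
  p q : Fin k → Fin n
  p i = Gap.p (gap i)
  q i = Gap.q (gap i)
  p≢u : ∀ i → p i ≢ u
  p≢u i = proj₁ (proj₂ (on-pair-∈ (Gap.p-on (gap i))))
  p≢v : ∀ i → p i ≢ v
  p≢v i = proj₂ (proj₂ (on-pair-∈ (Gap.p-on (gap i))))
  q∈C : ∀ i → q i ∈ C
  q∈C i = [ (λ on → proj₁ (on-pair-∈ on)) ,
            [ (λ q≡u → subst (_∈ C) (sym q≡u) u∈C) , (λ q≡v → subst (_∈ C) (sym q≡v) v∈C) ]′ ]′
          (Gap.q-on (gap i))
  p≡q⇒same : ∀ {i j} → p i ≡ q j → i ≡ j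
  p≡q⇒same {i} {j} pi≡qj =
    [ (λ on → on-one-pair (Gap.p-on (gap i)) (subst (OnPair j) (sym pi≡qj) on)) ,
      [ (λ qj≡u → contradiction (trans pi≡qj qj≡u) (p≢u i)) ,
        (λ qj≡v → contradiction (trans pi≡qj qj≡v) (p≢v i)) ]′ ]′ (Gap.q-on (gap j))
  edit : Fin (suc k) → Fin n × Fin n
  edit = (u , v) Vector.∷ λ i → p i , q i
  edit∈F : ∀ i → uncurry (mem F) (edit i) ≡ true
  edit∈F zero    = uv∈F
  edit∈F (suc i) = edited G F (p i) (q i)
    (clique (p i) (q i) (proj₁ (on-pair-∈ (Gap.p-on (gap i)))) (q∈C i) (Gap.p≢q (gap i)))
    (Gap.p≁q (gap i))
  edit-distinct : ∀ {i j} → SamePair (edit i) (edit j) → i ≡ j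
  edit-distinct {zero}  {zero}  _           = refl
  edit-distinct {zero}  {suc j} (inj₁ same) = contradiction (sym (cong proj₁ same)) (p≢u j)
  edit-distinct {zero}  {suc j} (inj₂ same) = contradiction (sym (cong proj₂ same)) (p≢v j)
  edit-distinct {suc i} {zero}  (inj₁ same) = contradiction (cong proj₁ same) (p≢u i)
  edit-distinct {suc i} {zero}  (inj₂ same) = contradiction (cong proj₁ same) (p≢v i)
  edit-distinct {suc i} {suc j} (inj₁ same) =
    cong suc (on-one-pair (Gap.p-on (gap i)) (subst (OnPair j) (sym (cong proj₁ same)) (Gap.p-on (gap j))))
  edit-distinct {suc i} {suc j} (inj₂ same) = cong suc (p≡q⇒same (cong proj₁ same))

-- A vertex w ∉ C misses a member of the big maximal clique C in G, hence
-- at least k+1 of them; if w were adjacent to all of C in G △ F, each of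
-- these k+1 pairs would be an edit.
stays-maximal : (G : Graph n) → Reduced G k → (F : EditSet n) → Solution G k F →
                {C : Subset n} → IsBigMaximalClique G k C →
                ∀ w → w ∉ C → ¬ (∀ u → u ∈ C → Edge (G △ F) u w)
stays-maximal {n = n} {k = k} G reduced F solution {C} (maximal , big) w w∉C adjacent-after
  with _ , a∈C , a≁w ← misses-member G maximal w∉C
  with c , c-injective , c∈ ← choose (C ─ nbhd G w)
                                 (many-non-neighbours G reduced (proj₁ maximal) big a∈C a≁w) =
  within-budget G F solution (edits≤size F edit edit-distinct edit∈F)
  where
  c∈C : ∀ i → c i ∈ C
  c∈C i = proj₁ (x∈p─q⁻ C (nbhd G w) (c∈ i))
  c≁w : ∀ i → adj G (c i) w ≡ false
  c≁w i = trans (Graph.sym G (c i) w) (∉nbhd G (proj₂ (x∈p─q⁻ C (nbhd G w) (c∈ i))))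
  edit : Fin (suc k) → Fin n × Fin n
  edit i = c i , w
  edit-distinct : ∀ {i j} → SamePair (edit i) (edit j) → i ≡ j
  edit-distinct     (inj₁ same)    = c-injective (cong proj₁ same)
  edit-distinct {i} (inj₂ swapped) = contradiction (subst (_∈ C) (cong proj₁ swapped) (c∈C i)) w∉C
  edit∈F : ∀ i → mem F (c i) w ≡ true
  edit∈F i = edited G F (c i) w (c≁w i) (adjacent-after (c i) (c∈C i))

survives : (G : Graph n) → Reduced G k → (F : EditSet n) → Solution G k F →
           ∀ C → IsBigMaximalClique G k C → IsMaximalClique (G △ F) C
survives G reduced F solution C big@((clique , _) , size) =
  (λ u v u∈C v∈C u≢v → cong₂ _xor_ (clique u v u∈C v∈C u≢v)
                         (unedited (no-edit-inside G F solution clique size u∈C v∈C u≢v))) ,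
  stays-maximal G reduced F solution big
  where
  unedited : ∀ {e} → e ≢ true → e ≡ false
  unedited {false} _      = refl
  unedited {true}  e≢true = contradiction refl e≢true

lemma4 : ∀ {n} (G : Graph n) (k : ℕ) → Reduced G k →
    (∀ C D → IsBigMaximalClique G k C → IsBigMaximalClique G k D →
       C ≢ D → ∣ C ∩ D ∣ ≤ 1)
    × (YesInstance G k → ∀ (F : EditSet n) → Solution G k F →
       ∀ C → IsBigMaximalClique G k C → IsMaximalClique (G △ F) C)
lemma4 G k reduced = share-at-most-one G reduced , λ _ → survives G reduced
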